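{- Let $v\in S_n$. Then $\Gamma_{[v,w_0]}\subseteq\bigcup_{(i,v_i)\in S}\overline{B}_{i,v_i}$, where $S$ is the set of spanning corners of $\Gamma_{[v,w_0]}$.
   Context: $S_n$ in one-line notation, Bruhat order, $w_0$ the longest element. $\Gamma_{[v,w_0]}:=\{(i,u_i): u\geq v,\ i\in[n]\}\subseteq[n]^2$ ((i,j) = row $i$, column $j$). For $i\in[n]$, $\overline{B}_{i,v_i}$ is the square region of $[n]^2$ with corners $(i,v_i)$, $(i,n-i+1)$, $(n-v_i+1,v_i)$, $(n-v_i+1,n-i+1)$. It is a bounding box of $\Gamma_{[v,w_0]}$ if there is no $j$ with $\overline{B}_{i,v_i}\subsetneq\overline{B}_{j,v_j}$, and in that case $(i,v_i)$ is called a spanning corner. -}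

module Defs where

open import Data.Nat using (ℕ; suc; _≤_; _∸_; _⊔_; _⊓_)
open import Data.Fin using (Fin; toℕ; _<_)
open import Data.Fin.Permutation using (Permutation′; _⟨$⟩ʳ_)
import Data.Fin.Permutation.Components as PC
open import Data.Product using (Σ; ∃; ∃-syntax; _×_; _,_)
open import Relation.Binary.PropositionalEquality using (_≡_)
open import Relation.Binary.Construct.Closure.ReflexiveTransitive using (Star)
open import Relation.Nullary using (¬_)

-- Permutations of [n] are elements of Permutation′ n (bijections Fin n ↔ Fin n).
-- One-line notation: u_i = u ⟨$⟩ʳ i. Positions/values are 1-indexed via pos.
pos : {n : ℕ} → Fin n → ℕ
pos i = suc (toℕ i)

-- Bruhat cover-type step: w = u · t_{ab} (swap the entries in positions a < b)
-- with u_a < u_b, i.e. ℓ(w) > ℓ(u).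
BruhatStep : {n : ℕ} → Permutation′ n → Permutation′ n → Set
BruhatStep {n} u w =
  Σ (Fin n) λ a → Σ (Fin n) λ b →
    (a < b) × ((u ⟨$⟩ʳ a) < (u ⟨$⟩ʳ b)) ×
    (∀ k → w ⟨$⟩ʳ k ≡ u ⟨$⟩ʳ (PC.transpose a b k))

_≤ᴮ_ : {n : ℕ} → Permutation′ n → Permutation′ n → Set
u ≤ᴮ w = Star BruhatStep u w

-- Points of [n]^2 (1-indexed, row r, column c); membership in Γ_{[v,w0]}.
InGamma : (n : ℕ) → Permutation′ n → ℕ → ℕ → Set
InGamma n v r c = ∃[ u ] (v ≤ᴮ u) × ∃[ i ] (pos i ≡ r × pos (u ⟨$⟩ʳ i) ≡ c)

-- The closed box \overline{B}_{i,v_i}: the rectangle with corners (i, v_i),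
-- (i, n-i+1), (n-v_i+1, v_i), (n-v_i+1, n-i+1).  Membership of (r, c).
InBox : (n : ℕ) → Permutation′ n → Fin n → ℕ → ℕ → Set
InBox n v i r c =
  let a = pos i ; b = pos (v ⟨$⟩ʳ i)
      a' = suc n ∸ b ; b' = suc n ∸ a
  in ((a ⊓ a') ≤ r × r ≤ (a ⊔ a')) × ((b ⊓ b') ≤ c × c ≤ (b ⊔ b'))

BoxSub : (n : ℕ) → Permutation′ n → Fin n → Fin n → Set
BoxSub n v i j = ∀ (r c : Fin n) → InBox n v i (pos r) (pos c) → InBox n v j (pos r) (pos c)

BoxStrictSub : (n : ℕ) → Permutation′ n → Fin n → Fin n → Set
BoxStrictSub n v i j =
  BoxSub n v i j × Σ (Fin n) λ r → Σ (Fin n) λ c →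
    InBox n v j (pos r) (pos c) × ¬ InBox n v i (pos r) (pos c)

SpanningCorner : (n : ℕ) → Permutation′ n → Fin n → Set
SpanningCorner n v i = ∀ j → ¬ BoxStrictSub n v i j

module Submission where

-- Write N = n + 1.  The box B_i of the corner (a, b) = (i, v_i) has rows
-- between a and a' = N ∸ b and columns between b = N ∸ a' and N ∸ a, so it is
-- the "symmetric box" [lo, hi] × [N ∸ hi, N ∸ lo] with lo = a ⊓ a', hi = a ⊔ a'.
--
-- 1. Exchange lemma: if (a, x) and (b, y) lie in symmetric boxes B and C with
--    a < b and x < y, then the exchanged points (a, y) and (b, x) lie in B ∪ C.
-- 2. Hence "every point (k, u_k) of the graph of u lies in ⋃ B_j" holds for
--    u = v (each corner lies in its own box) and survives every Bruhat step,
--    so it holds for all u ≥ v.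
-- 3. A strict inclusion B_j ⊊ B_k forces hi j ∸ lo j < hi k ∸ lo k, because
--    B_j contains its two opposite corners and nested intervals of equal
--    length coincide.
-- 4. Among the boxes containing a given point of Γ_[v,w₀], a widest one
--    (found with argmax) therefore cannot be strictly contained in another
--    box: it is the box of a spanning corner.

open import Defs
open import Data.Nat using (ℕ; suc; _≤_; _<_; _∸_; _⊔_; _⊓_; s≤s; _≤?_)
open import Data.Nat.Properties
open import Data.Fin using (Fin; opposite)
open import Data.Fin.Properties using (toℕ<n; opposite-prop)
import Data.Fin.Properties as Finₚ
open import Data.Fin.Permutation using (Permutation′; _⟨$⟩ʳ_)
import Data.Fin.Permutation.Components as PC
open import Data.Product using (∃-syntax; _×_; _,_; proj₁; proj₂)
open import Data.Sum using (_⊎_; inj₁; inj₂)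
open import Data.Empty using (⊥-elim)
open import Relation.Nullary using (Dec; yes; no)
open import Relation.Nullary.Decidable using (_×-dec_)
open import Relation.Unary using (Decidable)
open import Relation.Binary.PropositionalEquality
open import Relation.Binary.Construct.Closure.ReflexiveTransitive using (Star; ε; _◅_)
open import Data.List using (List; allFin; filter)
open import Data.List.Extrema.Nat using (argmax; argmax-all; f[xs]≤f[argmax])
open import Data.List.Membership.Propositional.Properties using (∈-allFin; ∈-filter⁺)
open import Data.List.Relation.Unary.All using (lookup)
open import Data.List.Relation.Unary.All.Properties using (all-filter)

SymBox : ℕ → ℕ → ℕ → ℕ → ℕ → Set
SymBox N lo hi r c = (lo ≤ r × r ≤ hi) × (N ∸ hi ≤ c × c ≤ N ∸ lo)

symBox? : ∀ N lo hi r c → Dec (SymBox N lo hi r c)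
symBox? N lo hi r c = ((lo ≤? r) ×-dec (r ≤? hi)) ×-dec ((N ∸ hi ≤? c) ×-dec (c ≤? N ∸ lo))

diagonal-corners : ∀ N a a' →
  SymBox N (a ⊓ a') (a ⊔ a') a (N ∸ a') × SymBox N (a ⊓ a') (a ⊔ a') a' (N ∸ a)
diagonal-corners N a a' =
  ((m⊓n≤m a a' , m≤m⊔n a a') , (∸-monoʳ-≤ N (m≤n⊔m a a') , ∸-monoʳ-≤ N (m⊓n≤n a a'))) ,
  ((m⊓n≤n a a' , m≤n⊔m a a') , (∸-monoʳ-≤ N (m≤m⊔n a a') , ∸-monoʳ-≤ N (m⊓n≤m a a')))

-- Exchange lemma, left point: (a, x) ∈ B, (b, y) ∈ C, a < b, x < y ⇒ (a, y) ∈ B ∪ C.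
-- If loC ≤ a then (a, y) ∈ C; otherwise loB ≤ a < loC gives y ≤ N ∸ loC ≤ N ∸ loB,
-- so (a, y) ∈ B.
exchange-left : ∀ {N loB hiB loC hiC a b x y} → a < b → x < y →
  SymBox N loB hiB a x → SymBox N loC hiC b y →
  SymBox N loB hiB a y ⊎ SymBox N loC hiC a y
exchange-left {N} {loB} {loC = loC} {a = a} {y = y} a<b x<y
  (rowB@(loB≤a , _) , (cB≤x , _)) ((_ , b≤hiC) , colC@(_ , y≤cC))
  with loC ≤? a | y ≤? N ∸ loB
... | yes loC≤a | _ = inj₂ ((loC≤a , ≤-trans (<⇒≤ a<b) b≤hiC) , colC)
... | no loC≰a | yes y≤cB = inj₁ (rowB , (≤-trans cB≤x (<⇒≤ x<y) , y≤cB))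
... | no loC≰a | no y≰cB = ⊥-elim (<⇒≱ (<-≤-trans (≰⇒> y≰cB) y≤cC)
                               (∸-monoʳ-≤ N (≤-trans loB≤a (<⇒≤ (≰⇒> loC≰a)))))

-- Exchange lemma, right point: under the same hypotheses (b, x) ∈ B ∪ C.
-- If b ≤ hiB then (b, x) ∈ B; otherwise hiB < b ≤ hiC gives N ∸ hiC ≤ N ∸ hiB ≤ x,
-- so (b, x) ∈ C.
exchange-right : ∀ {N loB hiB loC hiC a b x y} → a < b → x < y →
  SymBox N loB hiB a x → SymBox N loC hiC b y →
  SymBox N loB hiB b x ⊎ SymBox N loC hiC b x
exchange-right {N} {hiB = hiB} {hiC = hiC} {b = b} {x = x} a<b x<y
  ((loB≤a , _) , colB@(cB≤x , _)) (rowC@(_ , b≤hiC) , (_ , y≤cC))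
  with b ≤? hiB | N ∸ hiC ≤? x
... | yes b≤hiB | _ = inj₁ ((≤-trans loB≤a (<⇒≤ a<b) , b≤hiB) , colB)
... | no b≰hiB | yes cC≤x = inj₂ (rowC , (cC≤x , ≤-trans (<⇒≤ x<y) y≤cC))
... | no b≰hiB | no cC≰x = ⊥-elim (<⇒≱ (≤-<-trans cB≤x (≰⇒> cC≰x))
                               (∸-monoʳ-≤ N (≤-trans (<⇒≤ (≰⇒> b≰hiB)) b≤hiC)))

transpose-cases : ∀ {n} (a b k : Fin n) →
  (k ≡ a × PC.transpose a b k ≡ b) ⊎ (k ≡ b × PC.transpose a b k ≡ a) ⊎ PC.transpose a b k ≡ k
transpose-cases a b k with k Finₚ.≟ a
... | yes k≡a = inj₁ (k≡a , refl)
... | no _ with k Finₚ.≟ b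
...   | yes k≡b = inj₂ (inj₁ (k≡b , refl))
...   | no _ = inj₂ (inj₂ refl)

nested-intervals : ∀ {lj hj lk hk} → lk ≤ lj → lj ≤ hj → hj ≤ hk →
  (lk ≡ lj × hj ≡ hk) ⊎ hj ∸ lj < hk ∸ lk
nested-intervals {lj} {hj} {lk} {hk} lk≤lj lj≤hj hj≤hk
  with m≤n⇒m<n∨m≡n lk≤lj | m≤n⇒m<n∨m≡n hj≤hk
... | inj₁ lk<lj | _ = inj₂ (<-≤-trans (∸-monoʳ-< lk<lj lj≤hj) (∸-monoˡ-≤ lk hj≤hk))
... | inj₂ _ | inj₁ hj<hk = inj₂ (≤-<-trans (∸-monoʳ-≤ hj lk≤lj) (∸-monoˡ-< hj<hk (≤-trans lk≤lj lj≤hj)))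
... | inj₂ lk≡lj | inj₂ hj≡hk = inj₁ (lk≡lj , hj≡hk)

argmax-witness : ∀ {n} {P : Fin n → Set} → Decidable P → (f : Fin n → ℕ) →
  ∀ {j₀} → P j₀ → ∃[ j ] P j × (∀ k → P k → f k ≤ f j)
argmax-witness {n} P? f {j₀} Pj₀ =
  j , argmax-all f Pj₀ (all-filter P? (allFin n)) ,
  λ k Pk → lookup (f[xs]≤f[argmax] j₀ candidates) (∈-filter⁺ P? (∈-allFin k) Pk)
  where
  candidates : List (Fin n)
  candidates = filter P? (allFin n)
  j : Fin n
  j = argmax f j₀ candidates

pos-opposite : ∀ {n} (i : Fin n) → pos (opposite i) ≡ suc n ∸ pos i
pos-opposite {n} i = trans (cong suc (opposite-prop i)) (sym (+-∸-assoc 1 (toℕ<n i)))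

module Boxes (n : ℕ) (v : Permutation′ n) where

  N : ℕ
  N = suc n

  row row' lo hi width : Fin n → ℕ
  row i = pos i
  row' i = N ∸ pos (v ⟨$⟩ʳ i)
  lo i = row i ⊓ row' i
  hi i = row i ⊔ row' i
  width i = hi i ∸ lo i

  Box : Fin n → ℕ → ℕ → Set
  Box i = SymBox N (lo i) (hi i)

  lo≤hi : ∀ i → lo i ≤ hi i
  lo≤hi i = m⊓n≤m⊔n (row i) (row' i)

  column-corner : ∀ i → pos (v ⟨$⟩ʳ i) ≡ N ∸ row' i
  column-corner i = sym (m∸[m∸n]≡n (m≤n⇒m≤1+n (toℕ<n (v ⟨$⟩ʳ i))))

  column-low : ∀ i → pos (v ⟨$⟩ʳ i) ⊓ (N ∸ row i) ≡ N ∸ hi i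
  column-low i = begin
    pos (v ⟨$⟩ʳ i) ⊓ (N ∸ row i)  ≡⟨ cong (_⊓ (N ∸ row i)) (column-corner i) ⟩
    (N ∸ row' i) ⊓ (N ∸ row i)    ≡⟨ ∸-distribˡ-⊔-⊓ N (row' i) (row i) ⟨
    N ∸ (row' i ⊔ row i)          ≡⟨ cong (N ∸_) (⊔-comm (row' i) (row i)) ⟩
    N ∸ hi i                      ∎
    where open ≡-Reasoning

  column-high : ∀ i → pos (v ⟨$⟩ʳ i) ⊔ (N ∸ row i) ≡ N ∸ lo i
  column-high i = begin
    pos (v ⟨$⟩ʳ i) ⊔ (N ∸ row i)  ≡⟨ cong (_⊔ (N ∸ row i)) (column-corner i) ⟩
    (N ∸ row' i) ⊔ (N ∸ row i)    ≡⟨ ∸-distribˡ-⊓-⊔ N (row' i) (row i) ⟨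
    N ∸ (row' i ⊓ row i)          ≡⟨ cong (N ∸_) (⊓-comm (row' i) (row i)) ⟩
    N ∸ lo i                      ∎
    where open ≡-Reasoning

  inBox⇒box : ∀ i {r c} → InBox n v i r c → Box i r c
  inBox⇒box i (rows , (c-low , c-high)) =
    rows , (subst (_≤ _) (column-low i) c-low , subst (_ ≤_) (column-high i) c-high)

  box⇒inBox : ∀ i {r c} → Box i r c → InBox n v i r c
  box⇒inBox i (rows , (c-low , c-high)) =
    rows , (subst (_≤ _) (sym (column-low i)) c-low , subst (_ ≤_) (sym (column-high i)) c-high)

  corner-in-box : ∀ i → Box i (pos i) (pos (v ⟨$⟩ʳ i))
  corner-in-box i =
    subst (Box i (pos i)) (sym (column-corner i)) (proj₁ (diagonal-corners N (row i) (row' i)))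

  antipode-in-box : ∀ i → Box i (pos (opposite (v ⟨$⟩ʳ i))) (pos (opposite i))
  antipode-in-box i =
    subst₂ (Box i) (sym (pos-opposite (v ⟨$⟩ʳ i))) (sym (pos-opposite i))
      (proj₂ (diagonal-corners N (row i) (row' i)))

  InUnion : ℕ → ℕ → Set
  InUnion r c = ∃[ j ] Box j r c

  GraphCovered : Permutation′ n → Set
  GraphCovered u = ∀ k → InUnion (pos k) (pos (u ⟨$⟩ʳ k))

  covered-base : GraphCovered v
  covered-base k = k , corner-in-box k

  -- A Bruhat step u → u·t_ab only moves the points at rows a and b, and the
  -- exchange lemmas put the moved points back into the union.
  covered-step : ∀ {u w} → BruhatStep u w → GraphCovered u → GraphCovered w
  covered-step {u} (a , b , a<b , ua<ub , w≡u∘t) covered k =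
    subst (λ z → InUnion (pos k) (pos z)) (sym (w≡u∘t k)) (covered-swapped k)
    where
    union : ∀ {r c j j'} → Box j r c ⊎ Box j' r c → InUnion r c
    union {j = j} (inj₁ B) = j , B
    union {j' = j'} (inj₂ B) = j' , B

    covered-swapped : ∀ k → InUnion (pos k) (pos (u ⟨$⟩ʳ PC.transpose a b k))
    covered-swapped k with covered a | covered b | transpose-cases a b k
    ... | _ , Ba | _ , Bb | inj₁ (refl , t≡b) rewrite t≡b =
      union (exchange-left (s≤s a<b) (s≤s ua<ub) Ba Bb)
    ... | _ , Ba | _ , Bb | inj₂ (inj₁ (refl , t≡a)) rewrite t≡a =
      union (exchange-right (s≤s a<b) (s≤s ua<ub) Ba Bb)
    ... | _ | _ | inj₂ (inj₂ t≡k) rewrite t≡k = covered k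

  covered-above : ∀ {u} → v ≤ᴮ u → GraphCovered u
  covered-above = go covered-base
    where
    go : ∀ {u w} → GraphCovered u → Star BruhatStep u w → GraphCovered w
    go covered ε = covered
    go {u} covered (_◅_ {j = u'} step steps) = go (covered-step {u} {u'} step covered) steps

  -- An inclusion of boxes B_j ⊆ B_k nests their row intervals: B_j contains
  -- its corner at row j and its antipode at row N ∸ v_j.
  rows-nested : ∀ {j k} → BoxSub n v j k → lo k ≤ lo j × hi j ≤ hi k
  rows-nested {j} {k} sub =
    ⊓-glb (proj₁ corner-row) (proj₁ antipode-row) , ⊔-lub (proj₂ corner-row) (proj₂ antipode-row)
    where
    corner-row : lo k ≤ row j × row j ≤ hi k
    corner-row = proj₁ (sub j (v ⟨$⟩ʳ j) (box⇒inBox j (corner-in-box j)))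
    antipode-row : lo k ≤ row' j × row' j ≤ hi k
    antipode-row = subst (λ r → lo k ≤ r × r ≤ hi k) (pos-opposite (v ⟨$⟩ʳ j))
      (proj₁ (sub (opposite (v ⟨$⟩ʳ j)) (opposite j) (box⇒inBox j (antipode-in-box j))))

  -- A strictly larger box is strictly wider: boxes with the same row interval coincide.
  strict-sub-wider : ∀ {j k} → BoxStrictSub n v j k → width j < width k
  strict-sub-wider {j} {k} (sub , r , c , in-k , not-in-j)
    with nested-intervals (proj₁ (rows-nested sub)) (lo≤hi j) (proj₂ (rows-nested sub))
  ... | inj₂ narrower = narrower
  ... | inj₁ (lo≡ , hi≡) = ⊥-elim (not-in-j (box⇒inBox j
          (subst₂ (λ l h → SymBox N l h (pos r) (pos c)) lo≡ (sym hi≡) (inBox⇒box k in-k))))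

  widest-spanning : ∀ {j} (r c : Fin n) → Box j (pos r) (pos c) →
    (∀ k → Box k (pos r) (pos c) → width k ≤ width j) → SpanningCorner n v j
  widest-spanning {j} r c in-j widest k strict@(sub , _) =
    <⇒≱ (strict-sub-wider strict) (widest k (inBox⇒box k (sub r c (box⇒inBox j in-j))))

  -- Every point of [n]² covered by some box is covered by a spanning box: take a widest one.
  spanning-box-of-point : ∀ (r c : Fin n) → InUnion (pos r) (pos c) →
    ∃[ j ] SpanningCorner n v j × InBox n v j (pos r) (pos c)
  spanning-box-of-point r c (_ , in-j₀)
    with argmax-witness (λ k → symBox? N (lo k) (hi k) (pos r) (pos c)) width in-j₀
  ... | j , in-j , widest = j , widest-spanning r c in-j widest , box⇒inBox j in-j

lemma3p10 : (n : ℕ) (v : Permutation′ n) (r c : ℕ) → InGamma n v r c →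
    ∃[ i ] (SpanningCorner n v i × InBox n v i r c)
lemma3p10 n v _ _ (u , v≤u , i , refl , refl) =
  spanning-box-of-point i (u ⟨$⟩ʳ i) (covered-above v≤u i)
  where open Boxes n v
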